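{- Let $m\ge 4$ and $n\ge 3$, and let $S$ be a secure dominating set of $P_n\times K_m$. For $i\in[n]$ let $s_i=|S\cap X_i|$, where $X_i=\{(i,j):j\in[m]\}$. Then (i) $s_1+s_2+s_3\ge 4$, and (ii) $s_n+s_{n-1}+s_{n-2}\ge 4$.
   Context: $[n]=\{1,\dots,n\}$. $P_n$ is the path on $[n]$ with edges $\{i,i+1\}$; $K_m$ is the complete graph on $[m]$. The direct product $G\times H$ has vertex set $V(G)\times V(H)$ with $(g_1,h_1)\sim(g_2,h_2)$ iff $g_1g_2\in E(G)$ and $h_1h_2\in E(H)$; so in $P_n\times K_m$, $(i,j)\sim(i',j')$ iff $|i-i'|=1$ and $j\neq j'$. A set $D$ is dominating if every vertex not in $D$ is adjacent to a vertex of $D$. A set $S$ is a secure dominating set if it is dominating and for every vertex $w\notin S$ there is a neighbor $v\in S$ of $w$ such that $(S\setminus\{v\})\cup\{w\}$ is dominating. -}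

module Defs where

open import Data.Nat using (ℕ; suc; _+_)
open import Data.Fin using (Fin; toℕ)
open import Data.Fin.Subset using (Subset; Side; inside; outside; _∈_; _∉_; ∣_∣)
open import Data.Product using (Σ; _×_; _,_)
open import Data.Sum using (_⊎_)
open import Data.Vec using (_[_]≔_)
open import Data.Bool using (Bool; true; false)
open import Relation.Binary.PropositionalEquality using (_≡_)
open import Relation.Nullary using (¬_)
open import Relation.Nullary.Decidable using (⌊_⌋)
open import Data.Fin using (_≟_)

-- Vertices of P_n × K_m: pairs (i , j) with i : Fin n (path index, 0-based)
-- and j : Fin m.  Vertex (i , j) corresponds to the paper's (i+1 , j+1).
Vertex : ℕ → ℕ → Set
Vertex n m = Fin n × Fin m

PathAdj : ∀ {n} → Fin n → Fin n → Set
PathAdj i i' = (suc (toℕ i) ≡ toℕ i') ⊎ (suc (toℕ i') ≡ toℕ i)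

Adj : ∀ {n m} → Vertex n m → Vertex n m → Set
Adj (i , j) (i' , j') = PathAdj i i' × ¬ (j ≡ j')

-- A vertex set of P_n × K_m, given row by row: S i is the subset of
-- columns j with (i , j) ∈ S.  So S i represents S ∩ X_i.
VSet : ℕ → ℕ → Set
VSet n m = Fin n → Subset m

_∈V_ : ∀ {n m} → Vertex n m → VSet n m → Set
(i , j) ∈V S = j ∈ S i

_∉V_ : ∀ {n m} → Vertex n m → VSet n m → Set
v ∉V S = ¬ (v ∈V S)

setV : ∀ {n m} → VSet n m → Vertex n m → Side → VSet n m
setV S (i , j) b i' with ⌊ i ≟ i' ⌋
... | true  = S i' [ j ]≔ b
... | false = S i'

swap : ∀ {n m} → VSet n m → Vertex n m → Vertex n m → VSet n m
swap S v w = setV (setV S v outside) w inside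

Dominating : ∀ {n m} → VSet n m → Set
Dominating {n} {m} D =
  (w : Vertex n m) → w ∈V D ⊎ Σ (Vertex n m) (λ v → v ∈V D × Adj v w)

SecureDominating : ∀ {n m} → VSet n m → Set
SecureDominating {n} {m} S =
  Dominating S ×
  ((w : Vertex n m) → w ∉V S →
     Σ (Vertex n m) (λ v → v ∈V S × Adj v w × Dominating (swap S v w)))

rowCount : ∀ {n m} → VSet n m → Fin n → ℕ
rowCount S i = ∣ S i ∣

{-# OPTIONS --safe #-}
module Submission where

-- Let a, b, c be the numbers of vertices of S in the end row, its neighbour and the next
-- row, and suppose a + b + c ≤ 3 < m.  If the rows adjacent to a row t carry k ≤ 1 vertices
-- of S, then m ≤ |S ∩ X_t| + k: for k = 0 nothing can dominate row t from outside, so it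
-- lies in S; for k = 1 the single neighbour v must defend every vertex (t , j) ∉ S, after
-- which nothing adjacent to row t is left, so every other vertex of row t lies in S.
-- If b ≤ 1 this applied to the end row gives m ≤ a + b; otherwise a + c ≤ 1, and applied
-- to the middle row it gives m ≤ a + b + c.

open import Defs
open import Data.Nat using (ℕ; suc; _+_; _≤_; _<_; _∸_; z≤n; s≤s; _≤?_)
open import Data.Nat.Properties
  using (≤-trans; ≤-reflexive; m≤m+n; m≤n+m; +-mono-≤; +-monoʳ-≤; +-identityʳ;
         m≤n+m∸n; +-commutativeSemigroup; m≤n⇒m<n∨m≡n; <⇒≱; ≤⇒≯; ≰⇒>; <-irrefl; 1+n≢n; suc-injective; module ≤-Reasoning)
open import Algebra.Properties.CommutativeSemigroup +-commutativeSemigroup using (x∙yz≈yx∙z)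
open import Data.Fin using (Fin; toℕ; fromℕ<; _≟_)
open import Data.Fin.Properties using (toℕ-fromℕ<; fromℕ<-toℕ; toℕ<n; all?; ¬∀⟶∃¬)
open import Data.Fin.Subset using (Subset; Side; inside; _∈_; _∉_; _⊆_; ∁; ⁅_⁆; ⊤; ∣_∣)
open import Data.Fin.Subset.Properties
  using (_∈?_; p⊆q⇒∣p∣≤∣q∣; ∣⊤∣≡n; ∣⁅x⁆∣≡1; ∣∁p∣≡n∸∣p∣; x∈∁p⇒x∉p; x∈⁅y⁆⇔x≡y;
         x∈p⇒∣p-x∣<∣p∣; x∈p∧x≢y⇒x∈p-y)
open import Data.List using (List; []; _∷_; map)
open import Data.Nat.ListAction using (sum)
open import Data.List.Relation.Unary.Any using (here; there)
open import Data.List.Membership.Propositional using () renaming (_∈_ to _∈ₗ_)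
open import Data.Vec using (_[_]≔_)
open import Data.Vec.Properties using ([]=⇒lookup; lookup⇒[]=; lookup∘update; lookup∘update′)
open import Data.Product using (_×_; _,_; proj₁; proj₂)
open import Data.Product.Properties using (≡-dec)
open import Data.Sum using (_⊎_; inj₁; inj₂; [_,_])
open import Data.Empty using (⊥-elim)
open import Function using (_∘_)
open import Function.Bundles using (Equivalence)
open import Relation.Nullary using (¬_; yes; no)
open import Relation.Nullary.Decidable using (decidable-stable)
open import Relation.Binary.PropositionalEquality using (_≡_; _≢_; refl; sym; trans; cong; subst)

private
  variable
    n : ℕ
    x y : Fin n
    p : Subset n

x∈p⇒0<∣p∣ : x ∈ p → 0 < ∣ p ∣
x∈p⇒0<∣p∣ x∈p = ≤-trans (s≤s z≤n) (x∈p⇒∣p-x∣<∣p∣ x∈p)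

x∈p∧y∈p∧x≢y⇒1<∣p∣ : x ∈ p → y ∈ p → x ≢ y → 1 < ∣ p ∣
x∈p∧y∈p∧x≢y⇒1<∣p∣ x∈p y∈p x≢y =
  ≤-trans (s≤s (x∈p⇒0<∣p∣ (x∈p∧x≢y⇒x∈p-y y∈p (x≢y ∘ sym)))) (x∈p⇒∣p-x∣<∣p∣ x∈p)

∀x∈p⇒n≤∣p∣ : (p : Subset n) → (∀ x → x ∈ p) → n ≤ ∣ p ∣
∀x∈p⇒n≤∣p∣ {n} p all∈ = subst (_≤ ∣ p ∣) (∣⊤∣≡n n) (p⊆q⇒∣p∣≤∣q∣ {p = ⊤} (λ {x} _ → all∈ x))

∁p⊆⁅x⁆⇒n≤∣p∣+1 : (p : Subset n) (x : Fin n) → ∁ p ⊆ ⁅ x ⁆ → n ≤ ∣ p ∣ + 1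
∁p⊆⁅x⁆⇒n≤∣p∣+1 {n} p x ∁p⊆⁅x⁆ = begin
  n                  ≤⟨ m≤n+m∸n n ∣ p ∣ ⟩
  ∣ p ∣ + (n ∸ ∣ p ∣) ≡⟨ cong (∣ p ∣ +_) (∣∁p∣≡n∸∣p∣ p) ⟨
  ∣ p ∣ + ∣ ∁ p ∣     ≤⟨ +-monoʳ-≤ ∣ p ∣ (p⊆q⇒∣p∣≤∣q∣ ∁p⊆⁅x⁆) ⟩
  ∣ p ∣ + ∣ ⁅ x ⁆ ∣   ≡⟨ cong (∣ p ∣ +_) (∣⁅x⁆∣≡1 x) ⟩
  ∣ p ∣ + 1          ∎
  where open ≤-Reasoning

x∈p[y]≔s⁻ : (p : Subset n) (x y : Fin n) (s : Side) → x ∈ p [ y ]≔ s →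
            (x ≡ y × s ≡ inside) ⊎ (x ≢ y × x ∈ p)
x∈p[y]≔s⁻ p x y s x∈ with x ≟ y
... | yes refl = inj₁ (refl , trans (sym (lookup∘update x p s)) ([]=⇒lookup x∈))
... | no x≢y   = inj₂ (x≢y , lookup⇒[]= x p (trans (sym (lookup∘update′ x≢y p s)) ([]=⇒lookup x∈)))

PathAdj-irrefl : (i : Fin n) → ¬ PathAdj i i
PathAdj-irrefl i = [ 1+n≢n , 1+n≢n ]

module _ {n m : ℕ} where

  ∈setV⁻ : (S : VSet n m) (v w : Vertex n m) (s : Side) → w ∈V setV S v s →
           (w ≡ v × s ≡ inside) ⊎ (w ≢ v × w ∈V S)
  ∈setV⁻ S (i , j) (i′ , j′) s w∈ with i ≟ i′
  ... | no i≢i′ = inj₂ (i≢i′ ∘ sym ∘ cong proj₁ , w∈)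
  ... | yes refl with x∈p[y]≔s⁻ (S i) j′ j s w∈
  ...   | inj₁ (refl , s≡inside) = inj₁ (refl , s≡inside)
  ...   | inj₂ (j′≢j , j′∈)      = inj₂ (j′≢j ∘ cong proj₂ , j′∈)

  ∈swap⁻ : (S : VSet n m) (v w u : Vertex n m) → u ∈V swap S v w → u ≡ w ⊎ (u ≢ v × u ∈V S)
  ∈swap⁻ S v w u u∈ with ∈setV⁻ (setV S v _) w u inside u∈
  ... | inj₁ (u≡w , _) = inj₁ u≡w
  ... | inj₂ (_ , u∈′) with ∈setV⁻ S v u _ u∈′
  ...   | inj₁ (_ , ())
  ...   | inj₂ u≢v∧u∈S = inj₂ u≢v∧u∈S

module _ {n m : ℕ} {S : VSet n m} where

  NoneAdjacentTo : Fin n → Set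
  NoneAdjacentTo t = ∀ {i j} → j ∈ S i → ¬ PathAdj i t

  AtMostOneAdjacentTo : Fin n → Set
  AtMostOneAdjacentTo t =
    ∀ {u v} → u ∈V S → v ∈V S → PathAdj (proj₁ u) t → PathAdj (proj₁ v) t → u ≡ v

  full-row : Dominating S → (t : Fin n) → NoneAdjacentTo t → m ≤ ∣ S t ∣
  full-row dominating t isolated = ∀x∈p⇒n≤∣p∣ (S t) covered
    where
    covered : ∀ x → x ∈ S t
    covered x with dominating (t , x)
    ... | inj₁ x∈ = x∈
    ... | inj₂ ((i , j) , j∈ , i-adj , _) = ⊥-elim (isolated j∈ i-adj)

  missing-column-unique :
    SecureDominating S → (t : Fin n) → AtMostOneAdjacentTo t → ∀ {j x} → j ∉ S t → x ∉ S t → x ≡ j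
  missing-column-unique (_ , defend) t unique {j} {x} j∉ x∉ with defend (t , j) j∉
  ... | v , v∈ , (v-adj , _) , dominating′ =
    [ in-swap , (λ (u , u∈′ , u-adj , _) → ⊥-elim (no-neighbour u u∈′ u-adj)) ] (dominating′ (t , x))
    where
    in-swap : (t , x) ∈V swap S v (t , j) → x ≡ j
    in-swap x∈′ with ∈swap⁻ S v (t , j) (t , x) x∈′
    ... | inj₁ refl = refl
    ... | inj₂ (_ , x∈) = ⊥-elim (x∉ x∈)
    no-neighbour : ∀ u → u ∈V swap S v (t , j) → ¬ PathAdj (proj₁ u) t
    no-neighbour u u∈′ u-adj with ∈swap⁻ S v (t , j) u u∈′
    ... | inj₁ refl = PathAdj-irrefl t u-adj
    ... | inj₂ (u≢v , u∈) = u≢v (unique u∈ v∈ u-adj v-adj)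

  almost-full-row :
    SecureDominating S → (t : Fin n) → AtMostOneAdjacentTo t → m ≤ ∣ S t ∣ + 1
  almost-full-row secure t unique with all? (_∈? S t)
  ... | yes full = ≤-trans (∀x∈p⇒n≤∣p∣ (S t) full) (m≤m+n _ 1)
  ... | no ¬full with ¬∀⟶∃¬ m (_∈ S t) (_∈? S t) ¬full
  ...   | j , j∉ = ∁p⊆⁅x⁆⇒n≤∣p∣+1 (S t) j λ x∈∁ →
    Equivalence.from x∈⁅y⁆⇔x≡y (missing-column-unique secure t unique j∉ (x∈∁p⇒x∉p x∈∁))

  rowsCount : List (Fin n) → ℕ
  rowsCount rs = sum (map (∣_∣ ∘ S) rs)

  ∣S∣≤rowsCount : ∀ {r rs} → r ∈ₗ rs → ∣ S r ∣ ≤ rowsCount rs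
  ∣S∣≤rowsCount (here refl) = m≤m+n _ _
  ∣S∣≤rowsCount (there r∈) = ≤-trans (∣S∣≤rowsCount r∈) (m≤n+m _ _)

  distinct⇒1<rowsCount : ∀ {rs r r′ j j′} → r ∈ₗ rs → r′ ∈ₗ rs → j ∈ S r → j′ ∈ S r′ →
                         (r , j) ≢ (r′ , j′) → 1 < rowsCount rs
  distinct⇒1<rowsCount (here refl) (here refl) j∈ j′∈ ≢ =
    ≤-trans (x∈p∧y∈p∧x≢y⇒1<∣p∣ j∈ j′∈ (≢ ∘ cong (_ ,_))) (m≤m+n _ _)
  distinct⇒1<rowsCount (here refl) (there r′∈) j∈ j′∈ _ =
    +-mono-≤ (x∈p⇒0<∣p∣ j∈) (≤-trans (x∈p⇒0<∣p∣ j′∈) (∣S∣≤rowsCount r′∈))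
  distinct⇒1<rowsCount (there r∈) (here refl) j∈ j′∈ _ =
    +-mono-≤ (x∈p⇒0<∣p∣ j′∈) (≤-trans (x∈p⇒0<∣p∣ j∈) (∣S∣≤rowsCount r∈))
  distinct⇒1<rowsCount (there r∈) (there r′∈) j∈ j′∈ ≢ =
    ≤-trans (distinct⇒1<rowsCount r∈ r′∈ j∈ j′∈ ≢) (m≤n+m _ _)

  secure-row-bound : SecureDominating S → (t : Fin n) (rs : List (Fin n)) →
                     (∀ {r} → PathAdj r t → r ∈ₗ rs) → rowsCount rs ≤ 1 →
                     m ≤ ∣ S t ∣ + rowsCount rs
  secure-row-bound secure t rs neighbours count≤1 with m≤n⇒m<n∨m≡n count≤1
  ... | inj₁ count<1 = ≤-trans (full-row (proj₁ secure) t isolated) (m≤m+n _ _)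
    where
    isolated : NoneAdjacentTo t
    isolated j∈ i-adj = <⇒≱ count<1 (≤-trans (x∈p⇒0<∣p∣ j∈) (∣S∣≤rowsCount (neighbours i-adj)))
  ... | inj₂ count≡1 = subst (λ k → m ≤ ∣ S t ∣ + k) (sym count≡1) (almost-full-row secure t unique)
    where
    unique : AtMostOneAdjacentTo t
    unique {u} {v} u∈ v∈ u-adj v-adj = decidable-stable (≡-dec _≟_ _≟_ u v) λ u≢v →
      ≤⇒≯ count≤1 (distinct⇒1<rowsCount (neighbours u-adj) (neighbours v-adj) u∈ v∈ u≢v)

EndOfPath : ∀ {n} → Fin n → Fin n → Fin n → Set
EndOfPath e f g = (∀ {r} → PathAdj r e → r ≡ f) × (∀ {r} → PathAdj r f → r ≡ e ⊎ r ≡ g)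

end-window-count : ∀ {n m} {S : VSet n m} {e f g : Fin n} → SecureDominating S → 4 ≤ m →
                   EndOfPath e f g → 4 ≤ ∣ S e ∣ + ∣ S f ∣ + ∣ S g ∣
end-window-count {m = m} {S} {e} {f} {g} secure 4≤m (end , next)
  with ∣ S f ∣ ≤? 1 | ∣ S e ∣ + ∣ S g ∣ ≤? 1
... | yes b≤1 | _ = begin
  4                           ≤⟨ 4≤m ⟩
  m                           ≤⟨ secure-row-bound secure e (f ∷ []) (here ∘ end) b+0≤1 ⟩
  ∣ S e ∣ + (∣ S f ∣ + 0)     ≡⟨ cong (∣ S e ∣ +_) (+-identityʳ _) ⟩
  ∣ S e ∣ + ∣ S f ∣           ≤⟨ m≤m+n _ _ ⟩
  ∣ S e ∣ + ∣ S f ∣ + ∣ S g ∣ ∎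
  where
  open ≤-Reasoning
  b+0≤1 : ∣ S f ∣ + 0 ≤ 1
  b+0≤1 = ≤-trans (≤-reflexive (+-identityʳ _)) b≤1
... | no b≰1 | yes a+c≤1 = begin
  4                                   ≤⟨ 4≤m ⟩
  m                                   ≤⟨ secure-row-bound secure f (e ∷ g ∷ []) (adjacent ∘ next) a+c+0≤1 ⟩
  ∣ S f ∣ + (∣ S e ∣ + (∣ S g ∣ + 0)) ≡⟨ cong (λ c → ∣ S f ∣ + (∣ S e ∣ + c)) (+-identityʳ _) ⟩
  ∣ S f ∣ + (∣ S e ∣ + ∣ S g ∣)       ≡⟨ x∙yz≈yx∙z (∣ S f ∣) (∣ S e ∣) (∣ S g ∣) ⟩
  ∣ S e ∣ + ∣ S f ∣ + ∣ S g ∣         ∎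
  where
  open ≤-Reasoning
  adjacent : ∀ {r} → r ≡ e ⊎ r ≡ g → r ∈ₗ e ∷ g ∷ []
  adjacent = [ here , there ∘ here ]
  a+c+0≤1 : ∣ S e ∣ + (∣ S g ∣ + 0) ≤ 1
  a+c+0≤1 = ≤-trans (≤-reflexive (cong (∣ S e ∣ +_) (+-identityʳ _))) a+c≤1
... | no b≰1 | no a+c≰1 = begin
  4                             ≤⟨ +-mono-≤ (≰⇒> b≰1) (≰⇒> a+c≰1) ⟩
  ∣ S f ∣ + (∣ S e ∣ + ∣ S g ∣) ≡⟨ x∙yz≈yx∙z (∣ S f ∣) (∣ S e ∣) (∣ S g ∣) ⟩
  ∣ S e ∣ + ∣ S f ∣ + ∣ S g ∣   ∎
  where open ≤-Reasoning

PathAdj-fromℕ< : ∀ {n i} (i<n : i < n) {r : Fin n} → PathAdj r (fromℕ< i<n) →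
                 suc (toℕ r) ≡ i ⊎ toℕ r ≡ suc i
PathAdj-fromℕ< i<n (inj₁ 1+r≡i) = inj₁ (trans 1+r≡i (toℕ-fromℕ< i<n))
PathAdj-fromℕ< i<n (inj₂ 1+i≡r) = inj₂ (trans (sym 1+i≡r) (cong suc (toℕ-fromℕ< i<n)))

toℕ≡⇒≡fromℕ< : ∀ {n i} (i<n : i < n) {r : Fin n} → toℕ r ≡ i → r ≡ fromℕ< i<n
toℕ≡⇒≡fromℕ< i<n {r} refl = sym (fromℕ<-toℕ r i<n)

first-rows : ∀ {n} (p0 : 0 < n) (p1 : 1 < n) (p2 : 2 < n) →
             EndOfPath (fromℕ< p0) (fromℕ< p1) (fromℕ< p2)
first-rows p0 p1 p2 = end , next
  where
  end : ∀ {r} → PathAdj r (fromℕ< p0) → r ≡ fromℕ< p1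
  end adj with PathAdj-fromℕ< p0 adj
  ... | inj₁ ()
  ... | inj₂ r≡1 = toℕ≡⇒≡fromℕ< p1 r≡1
  next : ∀ {r} → PathAdj r (fromℕ< p1) → r ≡ fromℕ< p0 ⊎ r ≡ fromℕ< p2
  next adj with PathAdj-fromℕ< p1 adj
  ... | inj₁ 1+r≡1 = inj₁ (toℕ≡⇒≡fromℕ< p0 (suc-injective 1+r≡1))
  ... | inj₂ r≡2   = inj₂ (toℕ≡⇒≡fromℕ< p2 r≡2)

last-rows : ∀ {k} (q1 : 2 + k < 3 + k) (q2 : 1 + k < 3 + k) (q3 : k < 3 + k) →
            EndOfPath (fromℕ< q1) (fromℕ< q2) (fromℕ< q3)
last-rows q1 q2 q3 = end , next
  where
  end : ∀ {r} → PathAdj r (fromℕ< q1) → r ≡ fromℕ< q2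
  end adj with PathAdj-fromℕ< q1 adj
  ... | inj₁ 1+r≡2+k = toℕ≡⇒≡fromℕ< q2 (suc-injective 1+r≡2+k)
  ... | inj₂ r≡3+k   = ⊥-elim (<-irrefl r≡3+k (toℕ<n _))
  next : ∀ {r} → PathAdj r (fromℕ< q2) → r ≡ fromℕ< q1 ⊎ r ≡ fromℕ< q3
  next adj with PathAdj-fromℕ< q2 adj
  ... | inj₁ 1+r≡1+k = inj₂ (toℕ≡⇒≡fromℕ< q3 (suc-injective 1+r≡1+k))
  ... | inj₂ r≡2+k   = inj₁ (toℕ≡⇒≡fromℕ< q1 r≡2+k)

lemma5p3 : (n m : ℕ) → 4 ≤ m → (3≤n : 3 ≤ n) →
    (S : VSet n m) → SecureDominating S →
    (p0 : 0 < n) (p1 : 1 < n) (p2 : 2 < n)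
    (q1 : n ∸ 1 < n) (q2 : n ∸ 2 < n) (q3 : n ∸ 3 < n) →
    (4 ≤ rowCount S (fromℕ< p0) + rowCount S (fromℕ< p1) + rowCount S (fromℕ< p2))
    × (4 ≤ rowCount S (fromℕ< q1) + rowCount S (fromℕ< q2) + rowCount S (fromℕ< q3))
lemma5p3 _ _ 4≤m (s≤s (s≤s (s≤s z≤n))) S secure p0 p1 p2 q1 q2 q3 =
  end-window-count secure 4≤m (first-rows p0 p1 p2) ,
  end-window-count secure 4≤m (last-rows q1 q2 q3)
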